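{- For every resource $\alpha$ there is a cirquent $C$, in fact a literal cirquent, such that $C^\clubsuit=\alpha$.
   Context: Resources: a port is an atom $P$ (output) or $-P$ (input). An interface is a finite sequence $I=\langle X_1,\dots,X_n\rangle$ of ports; a situation for it is a bit string $\mathbf s$ of length $n$. $\mathbf s\le_I\mathbf s'$ iff for each $i$, $\mathbf s(i)\le\mathbf s'(i)$ if $X_i$ is an output and $\mathbf s'(i)\le\mathbf s(i)$ if $X_i$ is an input. A resource is a pair $\alpha=(\mathrm{Int}^\alpha,\mathrm{Tfn}^\alpha)$ of an interface and a function from its situations to $\{0,1\}$ that is monotone: $\mathbf s\le\mathbf s'$ implies $\mathrm{Tfn}^\alpha(\mathbf s)\le\mathrm{Tfn}^\alpha(\mathbf s')$. Formulas: built from atoms with $\neg,\wedge,\vee$, $\neg$ only on atoms; a literal is $P$ or $\neg P$. A $k$-ary cirquent is a pair consisting of a structure (a finite sequence, repetitions allowed, of subsets of $\{1,\dots,k\}$, called groups) and a pool $\langle F_1,\dots,F_k\rangle$ of formulas (oformulas); group $\Gamma$ contains $F_i$ for $i\in\Gamma$. A literal cirquent is one whose pool consists only of literals. A situation for a cirquent assigns truth values to all occurrences of atoms in its oformulas (a bit string, in order of appearance); an oformula is true in it by the classical recursive clauses applied to occurrences ($\neg P$ true iff that occurrence of $P$ is false); a group is true iff at least one of its oformulas is; the cirquent is true iff all its groups are. With $\mathrm{Port}(P)=P$, $\mathrm{Port}(\neg P)=-P$, the resource $C^\clubsuit$ has interface $\langle\mathrm{Port}(L_1),\dots,\mathrm{Port}(L_n)\rangle$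 where $L_1,\dots,L_n$ are the literal occurrences of $C$ in order of appearance, and is true in $\mathbf s$ iff $C$ is true in $\mathbf s$. -}

module Defs where

open import Data.Nat using (ℕ; suc)
open import Data.Bool using (Bool; true; false; not; _∧_; _∨_; _≤_)
open import Data.Product using (_×_; _,_)
open import Data.List using (List; []; _∷_; _++_; length; concatMap; map; foldr)
open import Data.Unit using (⊤)
open import Data.Empty using (⊥)
open import Data.Vec using (Vec; []; _∷_; lookup; toList; fromList)
open import Data.Fin using (Fin)
open import Data.Fin.Subset using (Subset)
open import Data.List using (allFin)

Atom : Set
Atom = ℕ

data Port : Set where
  out : Atom → Port
  inp : Atom → Port

Interface : Set
Interface = List Port

Situation : Interface → Set
Situation I = Vec Bool (length I)

portLeq : Port → Bool → Bool → Set
portLeq (out _) b b' = b ≤ b'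
portLeq (inp _) b b' = b' ≤ b

SitLeq : (I : Interface) → Situation I → Situation I → Set
SitLeq I s s' = ∀ (i : Fin (length I)) →
  portLeq (lookup (fromList I) i) (lookup s i) (lookup s' i)

record Resource : Set where
  field
    Int  : Interface
    Tfn  : Situation Int → Bool
    mono : ∀ (s s' : Situation Int) → SitLeq Int s s' → Tfn s ≤ Tfn s'
open Resource public

data Literal : Set where
  pos : Atom → Literal
  neg : Atom → Literal

data Formula : Set where
  lit  : Literal → Formula
  _∧ᶠ_ : Formula → Formula → Formula
  _∨ᶠ_ : Formula → Formula → Formula

isLiteralFormula : Formula → Set
isLiteralFormula (lit _) = ⊤
isLiteralFormula (_ ∧ᶠ _) = ⊥
isLiteralFormula (_ ∨ᶠ _) = ⊥

record Cirquent : Set where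
  field
    k         : ℕ
    structure : List (Subset k)
    pool      : Vec Formula k
open Cirquent public

isLiteralCirquent : Cirquent → Set
isLiteralCirquent C = ∀ (i : Fin (k C)) → isLiteralFormula (lookup (pool C) i)

litsF : Formula → List Literal
litsF (lit L)  = L ∷ []
litsF (A ∧ᶠ B) = litsF A ++ litsF B
litsF (A ∨ᶠ B) = litsF A ++ litsF B

litsC : Cirquent → List Literal
litsC C = concatMap litsF (toList (pool C))

portOf : Literal → Port
portOf (pos P) = out P
portOf (neg P) = inp P

-- Evaluation of an oformula, consuming the truth values of its atom
-- occurrences (in order of appearance) from the front of the bit list.
evalF : Formula → List Bool → Bool × List Bool
evalF (lit _)  []       = false , []      -- never arises for well-sized situations
evalF (lit (pos _)) (b ∷ bs) = b , bs
evalF (lit (neg _)) (b ∷ bs) = not b , bs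
evalF (A ∧ᶠ B) bs with evalF A bs
... | a , bs' with evalF B bs'
...   | b , bs'' = (a ∧ b) , bs''
evalF (A ∨ᶠ B) bs with evalF A bs
... | a , bs' with evalF B bs'
...   | b , bs'' = (a ∨ b) , bs''

evalPool : ∀ {n} → Vec Formula n → List Bool → Vec Bool n
evalPool [] _ = []
evalPool (F ∷ Fs) bs with evalF F bs
... | v , bs' = v ∷ evalPool Fs bs'

anyL : {A : Set} → (A → Bool) → List A → Bool
anyL p = foldr (λ x r → p x ∨ r) false

allL : {A : Set} → (A → Bool) → List A → Bool
allL p = foldr (λ x r → p x ∧ r) true

groupTrue : ∀ {n} → Vec Bool n → Subset n → Bool
groupTrue {n} vals Γ = anyL (λ i → lookup Γ i ∧ lookup vals i) (allFin n)

cirquentTrue : (C : Cirquent) → List Bool → Bool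
cirquentTrue C s = allL (groupTrue (evalPool (pool C) s)) (structure C)

clubInt : Cirquent → Interface
clubInt C = map portOf (litsC C)

clubTfn : (C : Cirquent) → Situation (clubInt C) → Bool
clubTfn C s = cirquentTrue C (toList s)

{-# OPTIONS --safe #-}
-- Take one literal per port, P for an output P and ¬P for an input -P, so that the
-- order ≤_I on situations is exactly the pointwise order of the literals' truth
-- values. For every situation t with α false at t, add the group of the literals
-- false at t. That group is false at s iff every literal true at s is true at t,
-- i.e. iff s ≤ t; by monotonicity this forces α false at s, and conversely if α is
-- false at s then the group built from t = s is false at s.
module Submission where

open import Defs
open import Data.Product using (Σ; _×_; _,_)
open import Relation.Binary.PropositionalEquality using (_≡_; subst; subst₂; refl; cong; sym; trans; module ≡-Reasoning)
open import Data.List using (length)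
open import Data.Vec using (Vec)
open import Data.Bool using (Bool)

open import Function using (_∘_)
open import Data.Nat using (zero; suc)
open import Data.Bool using (true; false; not; _∧_) renaming (_≤_ to _≤ᵇ_)
open import Data.Bool.Properties using (∧-inverseˡ; ≤-refl; ≤-minimum; ≤-maximum) renaming (_≟_ to _≟ᵇ_)
open import Data.Unit using (tt)
open import Relation.Nullary using (Dec; contradiction)
open import Data.Fin.Subset using (Subset; ∁)
open import Data.List as List using (List; []; _∷_; _++_; filter; concatMap; allFin)
open import Data.List.Relation.Unary.Any using (here; there)
open import Data.List.Membership.Propositional using (_∈_)
open import Data.List.Membership.Propositional.Properties
  using (∈-map⁺; ∈-++⁺ˡ; ∈-++⁺ʳ; ∈-allFin; ∈-map∘filter⁺; ∈-map∘filter⁻)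
open import Data.Vec as Vec using ([]; _∷_; lookup; toList; fromList; zipWith)
open import Data.Vec.Properties using (lookup-map; lookup-zipWith)

allL-true : ∀ {A : Set} (p : A → Bool) xs →
  (∀ {x} → x ∈ xs → p x ≡ true) → allL p xs ≡ true
allL-true p []       all = refl
allL-true p (x ∷ xs) all rewrite all (here refl) = allL-true p xs (all ∘ there)

allL-false : ∀ {A : Set} (p : A → Bool) {x} {xs} → x ∈ xs → p x ≡ false → allL p xs ≡ false
allL-false p {xs = y ∷ xs} (here refl) px≡false rewrite px≡false = refl
allL-false p {xs = y ∷ xs} (there x∈xs) px≡false with p y
... | true  = allL-false p x∈xs px≡false
... | false = refl

anyL-false⁺ : ∀ {A : Set} (p : A → Bool) xs →
  (∀ {x} → x ∈ xs → p x ≡ false) → anyL p xs ≡ false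
anyL-false⁺ p []       none = refl
anyL-false⁺ p (x ∷ xs) none rewrite none (here refl) = anyL-false⁺ p xs (none ∘ there)

anyL-false⁻ : ∀ {A : Set} (p : A → Bool) {x} {xs} → anyL p xs ≡ false → x ∈ xs → p x ≡ false
anyL-false⁻ p {xs = y ∷ xs} any≡false (here refl) with p y
... | false = refl
anyL-false⁻ p {xs = y ∷ xs} any≡false (there x∈xs) with p y
... | false = anyL-false⁻ p any≡false x∈xs

allBitVecs : ∀ n → List (Vec Bool n)
allBitVecs zero    = [] ∷ []
allBitVecs (suc n) = List.map (true ∷_) (allBitVecs n) ++ List.map (false ∷_) (allBitVecs n)

∈-allBitVecs : ∀ {n} (v : Vec Bool n) → v ∈ allBitVecs n
∈-allBitVecs []         = here refl
∈-allBitVecs (true ∷ v) = ∈-++⁺ˡ (∈-map⁺ (true ∷_) (∈-allBitVecs v))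
∈-allBitVecs {suc n} (false ∷ v) =
  ∈-++⁺ʳ (List.map (true ∷_) (allBitVecs n)) (∈-map⁺ (false ∷_) (∈-allBitVecs v))

not∧≡false⇒≤ : ∀ a b → not b ∧ a ≡ false → a ≤ᵇ b
not∧≡false⇒≤ false b     _ = ≤-minimum b
not∧≡false⇒≤ true  true  _ = ≤-refl
not∧≡false⇒≤ true  false ()

groupTrue-∁-self : ∀ {n} (v : Vec Bool n) → groupTrue v (∁ v) ≡ false
groupTrue-∁-self {n} v = anyL-false⁺ _ (allFin n) λ {i} _ →
  trans (cong (_∧ lookup v i) (lookup-map i not v)) (∧-inverseˡ (lookup v i))

groupTrue-∁≡false⇒≤ : ∀ {n} (v w : Vec Bool n) → groupTrue v (∁ w) ≡ false →
  ∀ i → lookup v i ≤ᵇ lookup w i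
groupTrue-∁≡false⇒≤ v w group≡false i = not∧≡false⇒≤ (lookup v i) (lookup w i)
  (trans (cong (_∧ lookup v i) (sym (lookup-map i not w)))
         (anyL-false⁻ _ group≡false (∈-allFin i)))

literalOf : Port → Literal
literalOf (out P) = pos P
literalOf (inp P) = neg P

literalValue : Port → Bool → Bool
literalValue (out _) b = b
literalValue (inp _) b = not b

literalValues : ∀ {n} → Vec Port n → Vec Bool n → Vec Bool n
literalValues = zipWith literalValue

literalValue-reflects-≤ : ∀ p a b → literalValue p a ≤ᵇ literalValue p b → portLeq p a b
literalValue-reflects-≤ (out _) a     b     a≤b = a≤b
literalValue-reflects-≤ (inp _) true  b     _   = ≤-maximum b
literalValue-reflects-≤ (inp _) false false _   = ≤-refl
literalValue-reflects-≤ (inp _) false true  ()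

literalValues-reflects-≤ : (I : Interface) (s t : Situation I) →
  (∀ i → lookup (literalValues (fromList I) s) i ≤ᵇ lookup (literalValues (fromList I) t) i) →
  SitLeq I s t
literalValues-reflects-≤ I s t s≤t i = literalValue-reflects-≤ (lookup ports i) (lookup s i) (lookup t i)
  (subst₂ _≤ᵇ_ (lookup-zipWith literalValue i ports s) (lookup-zipWith literalValue i ports t) (s≤t i))
  where
  ports = fromList I

literalPool : ∀ {n} → Vec Port n → Vec Formula n
literalPool = Vec.map (lit ∘ literalOf)

lookup-literalPool-isLiteral : ∀ {n} (ports : Vec Port n) i → isLiteralFormula (lookup (literalPool ports) i)
lookup-literalPool-isLiteral ports i = subst isLiteralFormula (sym (lookup-map i (lit ∘ literalOf) ports)) tt

ports-literalPool : (I : Interface) → List.map portOf (concatMap litsF (toList (literalPool (fromList I)))) ≡ I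
ports-literalPool []          = refl
ports-literalPool (out P ∷ I) = cong (out P ∷_) (ports-literalPool I)
ports-literalPool (inp P ∷ I) = cong (inp P ∷_) (ports-literalPool I)

evalPool-literalPool : ∀ {n} (ports : Vec Port n) (s : Vec Bool n) →
  evalPool (literalPool ports) (toList s) ≡ literalValues ports s
evalPool-literalPool []              []      = refl
evalPool-literalPool (out _ ∷ ports) (b ∷ s) = cong (b ∷_) (evalPool-literalPool ports s)
evalPool-literalPool (inp _ ∷ ports) (b ∷ s) = cong (not b ∷_) (evalPool-literalPool ports s)

toList-subst : ∀ {I J : Interface} (e : I ≡ J) (s : Situation I) → toList (subst Situation e s) ≡ toList s
toList-subst refl s = refl

module Canonical (α : Resource) where

  ports : Vec Port (length (Int α))
  ports = fromList (Int α)

  isCounterexample? : (t : Situation (Int α)) → Dec (Tfn α t ≡ false)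
  isCounterexample? t = Tfn α t ≟ᵇ false

  counterexampleGroups : List (Subset (length (Int α)))
  counterexampleGroups = List.map (∁ ∘ literalValues ports) (filter isCounterexample? (allBitVecs _))

  cirquent : Cirquent
  cirquent = record { k = length (Int α) ; structure = counterexampleGroups ; pool = literalPool ports }

  cirquent-isLiteral : isLiteralCirquent cirquent
  cirquent-isLiteral = lookup-literalPool-isLiteral ports

  clubInt-cirquent : clubInt cirquent ≡ Int α
  clubInt-cirquent = ports-literalPool (Int α)

  counterexampleGroup-true : (s t : Situation (Int α)) → Tfn α s ≡ true → Tfn α t ≡ false →
    groupTrue (literalValues ports s) (∁ (literalValues ports t)) ≡ true
  counterexampleGroup-true s t α[s] α[t] with groupTrue (literalValues ports s) (∁ (literalValues ports t)) in group≡
  ... | true  = refl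
  ... | false = contradiction (subst₂ _≤ᵇ_ α[s] α[t] (mono α s t s≤t)) λ ()
    where
    s≤t : SitLeq (Int α) s t
    s≤t = literalValues-reflects-≤ (Int α) s t
      (groupTrue-∁≡false⇒≤ (literalValues ports s) (literalValues ports t) group≡)

  cirquentTrue-cirquent : (s : Situation (Int α)) → cirquentTrue cirquent (toList s) ≡ Tfn α s
  cirquentTrue-cirquent s rewrite evalPool-literalPool ports s with Tfn α s in α[s]
  ... | false = allL-false _
        (∈-map∘filter⁺ (∁ ∘ literalValues ports) isCounterexample? (s , ∈-allBitVecs s , refl , α[s]))
        (groupTrue-∁-self (literalValues ports s))
  ... | true = allL-true _ counterexampleGroups λ Γ∈ →
    let t , _ , Γ≡ , α[t] = ∈-map∘filter⁻ (∁ ∘ literalValues ports) isCounterexample? {xs = allBitVecs _} Γ∈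
    in subst (λ Γ → groupTrue (literalValues ports s) Γ ≡ true) (sym Γ≡) (counterexampleGroup-true s t α[s] α[t])

theorem8p8 : (α : Resource) → Σ Cirquent (λ C → isLiteralCirquent C × Σ (clubInt C ≡ Int α) (λ e → (s : Situation (clubInt C)) → clubTfn C s ≡ Tfn α (subst Situation e s)))
theorem8p8 α = cirquent , cirquent-isLiteral , clubInt-cirquent , truth
  where
  open Canonical α
  open ≡-Reasoning
  truth : (s : Situation (clubInt cirquent)) → clubTfn cirquent s ≡ Tfn α (subst Situation clubInt-cirquent s)
  truth s = begin
    cirquentTrue cirquent (toList s)
      ≡⟨ cong (cirquentTrue cirquent) (sym (toList-subst clubInt-cirquent s)) ⟩
    cirquentTrue cirquent (toList (subst Situation clubInt-cirquent s))
      ≡⟨ cirquentTrue-cirquent (subst Situation clubInt-cirquent s) ⟩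
    Tfn α (subst Situation clubInt-cirquent s) ∎
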